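{- Let $G$ and $H$ be connected graphs. Then $v_s(G)\,v_s(H) \le Z(G \Box H)$.
   Context: Graphs are finite and simple. A leaf is a vertex of degree $1$; a strong support vertex is a vertex adjacent to at least two leaves; $v_s(G)$ denotes the number of strong support vertices of $G$. A set $Z \subseteq V(G)$ is a zero forcing set if, starting with the vertices of $Z$ observed and repeatedly letting any observed vertex with exactly one unobserved neighbor make that neighbor observed, eventually all vertices are observed; $Z(G)$ is the minimum size of a zero forcing set. The Cartesian product $G \Box H$ has vertex set $V(G)\times V(H)$, with $(g_1,h_1)$ adjacent to $(g_2,h_2)$ iff either $g_1=g_2$ and $h_1h_2 \in E(H)$, or $h_1=h_2$ and $g_1g_2\in E(G)$. -}

module Defs where

open import Data.Nat using (ℕ; _*_; _≤_; _≡ᵇ_)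
open import Data.Bool using (Bool; true; false; _∧_; _∨_; T; not)
open import Data.Fin using (Fin; toℕ; remQuot)
open import Data.Fin.Subset using (Subset; ∣_∣; _∈_)
open import Data.Vec using (tabulate)
open import Data.Product using (_×_; _,_; proj₁; proj₂)
open import Relation.Binary.PropositionalEquality using (_≡_; _≢_)
open import Relation.Nullary using (¬_)

record Graph : Set where
  constructor mkGraph
  field
    n   : ℕ
    adj : Fin n → Fin n → Bool

open Graph public

record IsSimple (G : Graph) : Set where
  field
    symmetric   : ∀ u v → adj G u v ≡ adj G v u
    irreflexive : ∀ u → adj G u u ≡ false

data Reach (G : Graph) : Fin (n G) → Fin (n G) → Set where
  here : ∀ {u} → Reach G u u
  step : ∀ {u v w} → T (adj G u v) → Reach G v w → Reach G u w

Connected : Graph → Set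
Connected G = ∀ u v → Reach G u v

N : (G : Graph) → Fin (n G) → Subset (n G)
N G u = tabulate (adj G u)

degree : (G : Graph) → Fin (n G) → ℕ
degree G u = ∣ N G u ∣

isLeaf : (G : Graph) → Fin (n G) → Bool
isLeaf G v = degree G v ≡ᵇ 1

leafNeighbours : (G : Graph) → Fin (n G) → ℕ
leafNeighbours G u = ∣ tabulate (λ v → adj G u v ∧ isLeaf G v) ∣

-- Strong support vertex: adjacent to at least two leaves.
isStrongSupport : (G : Graph) → Fin (n G) → Bool
isStrongSupport G u = not (leafNeighbours G u ≡ᵇ 0) ∧ not (leafNeighbours G u ≡ᵇ 1)

vs : Graph → ℕ
vs G = ∣ tabulate (isStrongSupport G) ∣

-- Zero forcing: the set of vertices eventually observed from S is the least
-- set containing S and closed under the colour-change rule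
-- (an observed u all of whose neighbours other than v are observed forces
-- its neighbour v).
data Observed (G : Graph) (S : Subset (n G)) : Fin (n G) → Set where
  initial : ∀ {v} → v ∈ S → Observed G S v
  force   : ∀ {u v} → Observed G S u → T (adj G u v)
          → (∀ w → T (adj G u w) → w ≢ v → Observed G S w)
          → Observed G S v

IsZeroForcingSet : (G : Graph) → Subset (n G) → Set
IsZeroForcingSet G S = ∀ v → Observed G S v

-- Cartesian product G □ H on Fin (n G * n H); index k corresponds to the
-- pair remQuot (n H) k = (g , h).
finEq : ∀ {m} → Fin m → Fin m → Bool
finEq i j = toℕ i ≡ᵇ toℕ j

_□_ : Graph → Graph → Graph
G □ H = mkGraph (n G * n H) λ k l →
  let p = remQuot (n H) k ; q = remQuot (n H) l in
  (finEq (proj₁ p) (proj₁ q) ∧ adj H (proj₂ p) (proj₂ q))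
  ∨ (finEq (proj₂ p) (proj₂ q) ∧ adj G (proj₁ p) (proj₁ q))

-- Call F a fort if every vertex outside F with a neighbour in F has at least two neighbours
-- in F. No vertex of a fort disjoint from S is ever observed, so a zero forcing set meets every
-- nonempty fort. Two leaves hanging from a common vertex form a fort, and a product of forts of
-- G and H is a fort of G □ H. Choosing two leaves at each strong support vertex thus gives
-- vs G * vs H forts of G □ H, pairwise disjoint because a leaf has a single neighbour, and
-- picking a vertex of S in each one injects the pairs of strong support vertices into S.

module Submission where

open import Defs
open import Data.Nat using (_*_; _≤_)
open import Data.Fin.Subset using (Subset; ∣_∣)

open import Level using (0ℓ)
open import Data.Nat using (zero; suc; _≡ᵇ_; s≤s; z≤n; z<s; _<_)
open import Data.Nat.Properties using (≡ᵇ⇒≡; ≡⇒≡ᵇ; <-trans; 0≢1+n; 1+n≰n)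
open import Data.Bool using (Bool; T; not; _∧_)
open import Data.Bool.Properties using (T-≡; T-∧; T-∨)
open import Data.Fin using (Fin; toℕ; zero; suc; fromℕ<; remQuot; combine; _≟_)
open import Data.Fin.Properties
  using ( toℕ-fromℕ<; suc-injective; toℕ-injective; any?; injective⇒≤
        ; remQuot-combine; combine-remQuot)
open import Data.Fin.Subset using (_∈_; _∉_; inside; outside)
open import Data.Fin.Subset.Properties using (_∈?_)
open import Data.Vec using (_∷_; tabulate; here; there)
open import Data.Vec.Properties using (lookup∘tabulate; []=⇒lookup; lookup⇒[]=)
open import Data.Product using (_×_; _,_; proj₁; proj₂; ∃; ∃-syntax; uncurry)
open import Data.Sum using (_⊎_; inj₁; inj₂)
open import Data.Empty using (⊥-elim)
open import Function using (_∘_; Equivalence)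
open import Function.Definitions using (Injective)
open import Relation.Binary.PropositionalEquality
open import Relation.Nullary using (¬_; yes; no; _×-dec_; _⊎-dec_)
open import Relation.Unary using (Pred; Decidable)

enumerate : ∀ {n} (p : Subset n) → Fin ∣ p ∣ → Fin n
enumerate (inside ∷ p) zero = zero
enumerate (inside ∷ p) (suc i) = suc (enumerate p i)
enumerate (outside ∷ p) i = suc (enumerate p i)

enumerate-∈ : ∀ {n} (p : Subset n) (i : Fin ∣ p ∣) → enumerate p i ∈ p
enumerate-∈ (inside ∷ p) zero = here
enumerate-∈ (inside ∷ p) (suc i) = there (enumerate-∈ p i)
enumerate-∈ (outside ∷ p) i = there (enumerate-∈ p i)

enumerate-injective : ∀ {n} (p : Subset n) → Injective _≡_ _≡_ (enumerate p)
enumerate-injective (inside ∷ p) {zero} {zero} _ = refl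
enumerate-injective (inside ∷ p) {suc i} {suc j} eq =
  cong suc (enumerate-injective p (suc-injective eq))
enumerate-injective (outside ∷ p) eq = enumerate-injective p (suc-injective eq)

rank : ∀ {n} (p : Subset n) {x : Fin n} → x ∈ p → Fin ∣ p ∣
rank (inside ∷ p) here = zero
rank (inside ∷ p) (there x∈p) = suc (rank p x∈p)
rank (outside ∷ p) (there x∈p) = rank p x∈p

rank-injective : ∀ {n} (p : Subset n) {x y : Fin n} (x∈p : x ∈ p) (y∈p : y ∈ p) →
                 rank p x∈p ≡ rank p y∈p → x ≡ y
rank-injective (inside ∷ p) here here _ = refl
rank-injective (inside ∷ p) (there x∈p) (there y∈p) eq =
  cong suc (rank-injective p x∈p y∈p (suc-injective eq))
rank-injective (outside ∷ p) (there x∈p) (there y∈p) eq =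
  cong suc (rank-injective p x∈p y∈p eq)

x∈p∧y∈p∧x≢y⇒2≤∣p∣ : ∀ {n} {p : Subset n} {x y} → x ∈ p → y ∈ p → x ≢ y → 2 ≤ ∣ p ∣
x∈p∧y∈p∧x≢y⇒2≤∣p∣ {p = p} x∈p y∈p x≢y = injective⇒≤ pick-injective
  where
  pick : Fin 2 → Fin ∣ p ∣
  pick zero = rank p x∈p
  pick (suc zero) = rank p y∈p
  pick-injective : Injective _≡_ _≡_ pick
  pick-injective {zero} {zero} _ = refl
  pick-injective {zero} {suc zero} eq = ⊥-elim (x≢y (rank-injective p x∈p y∈p eq))
  pick-injective {suc zero} {zero} eq = ⊥-elim (x≢y (sym (rank-injective p y∈p x∈p eq)))
  pick-injective {suc zero} {suc zero} _ = refl

2≤∣p∣⇒∃x∈p∧y∈p∧x≢y : ∀ {n} (p : Subset n) → 2 ≤ ∣ p ∣ →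
                     ∃[ x ] ∃[ y ] x ∈ p × y ∈ p × x ≢ y
2≤∣p∣⇒∃x∈p∧y∈p∧x≢y p 2≤∣p∣ =
  enumerate p i₀ , enumerate p i₁ , enumerate-∈ p i₀ , enumerate-∈ p i₁ ,
  λ eq → 0≢1+n (trans (sym (toℕ-fromℕ< 0<∣p∣))
                  (trans (cong toℕ (enumerate-injective p eq)) (toℕ-fromℕ< 2≤∣p∣)))
  where
  0<∣p∣ : 0 < ∣ p ∣
  0<∣p∣ = <-trans z<s 2≤∣p∣
  i₀ i₁ : Fin ∣ p ∣
  i₀ = fromℕ< 0<∣p∣
  i₁ = fromℕ< 2≤∣p∣

remQuot-injective : ∀ {m} n → Injective _≡_ _≡_ (remQuot {m} n)
remQuot-injective {m} n {a} {b} eq = begin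
  a                                 ≡⟨ combine-remQuot {m} n a ⟨
  uncurry combine (remQuot {m} n a) ≡⟨ cong (uncurry combine) eq ⟩
  uncurry combine (remQuot {m} n b) ≡⟨ combine-remQuot {m} n b ⟩
  b                                 ∎
  where open ≡-Reasoning

∈-tabulate⁺ : ∀ {n} {f : Fin n → Bool} {x} → T (f x) → x ∈ tabulate f
∈-tabulate⁺ {f = f} {x} fx =
  lookup⇒[]= x (tabulate f) (trans (lookup∘tabulate f x) (Equivalence.to T-≡ fx))

∈-tabulate⁻ : ∀ {n} {f : Fin n → Bool} {x} → x ∈ tabulate f → T (f x)
∈-tabulate⁻ {f = f} {x} x∈ =
  Equivalence.from T-≡ (trans (sym (lookup∘tabulate f x)) ([]=⇒lookup x∈))

IsFort : (G : Graph) → Pred (Fin (n G)) 0ℓ → Set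
IsFort G F = ∀ {w v} → ¬ F w → F v → T (adj G w v) →
             ∃[ v′ ] v′ ≢ v × F v′ × T (adj G w v′)

module _ {G : Graph} {S : Subset (n G)} {F : Pred (Fin (n G)) 0ℓ}
         (F? : Decidable F) (fort : IsFort G F) where

  -- The vertex forcing into F is itself in F, or else the fort gives it a second neighbour in F
  -- that must already be observed.
  fort-unobserved : (∀ {v} → F v → v ∉ S) → ∀ {v} → F v → ¬ Observed G S v
  fort-unobserved F∩S=∅ Fv (initial v∈S) = F∩S=∅ Fv v∈S
  fort-unobserved F∩S=∅ Fv (force {u} obs-u uv others) with F? u
  ... | yes Fu = fort-unobserved F∩S=∅ Fu obs-u
  ... | no ¬Fu with fort ¬Fu Fv uv
  ...   | v′ , v′≢v , Fv′ , uv′ = fort-unobserved F∩S=∅ Fv′ (others v′ uv′ v′≢v)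

  zeroForcingSet-meets-fort : IsZeroForcingSet G S → ∃ F → ∃[ v ] v ∈ S × F v
  zeroForcingSet-meets-fort zf (v , Fv) with any? (λ v → (v ∈? S) ×-dec F? v)
  ... | yes witness = witness
  ... | no none = ⊥-elim (fort-unobserved (λ Fv v∈S → none (_ , v∈S , Fv)) Fv (zf v))

finEq-sound : ∀ {m} {i j : Fin m} → T (finEq i j) → i ≡ j
finEq-sound {i = i} {j} eq = toℕ-injective (≡ᵇ⇒≡ (toℕ i) (toℕ j) eq)

finEq-complete : ∀ {m} {i j : Fin m} → i ≡ j → T (finEq i j)
finEq-complete {i = i} {j} eq = ≡⇒≡ᵇ (toℕ i) (toℕ j) (cong toℕ eq)

_⊠_ : ∀ {m n} → Pred (Fin m) 0ℓ → Pred (Fin n) 0ℓ → Pred (Fin (m * n)) 0ℓ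
_⊠_ {m} {n} F₁ F₂ k = F₁ (proj₁ (remQuot {m} n k)) × F₂ (proj₂ (remQuot {m} n k))

⊠-dec : ∀ {m n} {F₁ : Pred (Fin m) 0ℓ} {F₂ : Pred (Fin n) 0ℓ} →
        Decidable F₁ → Decidable F₂ → Decidable (F₁ ⊠ F₂)
⊠-dec {m} {n} F₁? F₂? k = F₁? (proj₁ (remQuot {m} n k)) ×-dec F₂? (proj₂ (remQuot {m} n k))

⊠-combine : ∀ {m n} {F₁ : Pred (Fin m) 0ℓ} {F₂ : Pred (Fin n) 0ℓ} {g h} →
            F₁ g → F₂ h → (F₁ ⊠ F₂) (combine g h)
⊠-combine {F₁ = F₁} {F₂} {g} {h} F₁g F₂h =
  subst (λ (g , h) → F₁ g × F₂ h) (sym (remQuot-combine g h)) (F₁g , F₂h)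

module _ {G H : Graph} where

  coords : Fin (n (G □ H)) → Fin (n G) × Fin (n H)
  coords = remQuot (n H)

  □-adj⁻ : ∀ {k l} → T (adj (G □ H) k l) →
           proj₁ (coords k) ≡ proj₁ (coords l) × T (adj H (proj₂ (coords k)) (proj₂ (coords l)))
           ⊎ proj₂ (coords k) ≡ proj₂ (coords l) × T (adj G (proj₁ (coords k)) (proj₁ (coords l)))
  □-adj⁻ kl with Equivalence.to T-∨ kl
  ... | inj₁ t = let (eq , hh′) = Equivalence.to T-∧ t in inj₁ (finEq-sound eq , hh′)
  ... | inj₂ t = let (eq , gg′) = Equivalence.to T-∧ t in inj₂ (finEq-sound eq , gg′)

  coords-combine : ∀ g h → coords (combine g h) ≡ (g , h)
  coords-combine = remQuot-combine

  □-adjᴴ : ∀ {k g h} → proj₁ (coords k) ≡ g → T (adj H (proj₂ (coords k)) h) →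
           T (adj (G □ H) k (combine g h))
  □-adjᴴ {k} {g} {h} eq hh′ = Equivalence.from T-∨ (inj₁ (Equivalence.from T-∧
    ( finEq-complete (trans eq (sym (cong proj₁ (coords-combine g h))))
    , subst (T ∘ adj H _) (sym (cong proj₂ (coords-combine g h))) hh′ )))

  □-adjᴳ : ∀ {k g h} → proj₂ (coords k) ≡ h → T (adj G (proj₁ (coords k)) g) →
           T (adj (G □ H) k (combine g h))
  □-adjᴳ {k} {g} {h} eq gg′ = Equivalence.from T-∨ (inj₂ (Equivalence.from T-∧
    ( finEq-complete (trans eq (sym (cong proj₂ (coords-combine g h))))
    , subst (T ∘ adj G _) (sym (cong proj₁ (coords-combine g h))) gg′ )))

  combine≢ˡ : ∀ {g h} {k : Fin (n (G □ H))} → g ≢ proj₁ (coords k) → combine g h ≢ k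
  combine≢ˡ {g} {h} g≢ eq =
    g≢ (trans (cong proj₁ (sym (coords-combine g h))) (cong (proj₁ ∘ coords) eq))

  combine≢ʳ : ∀ {g h} {k : Fin (n (G □ H))} → h ≢ proj₂ (coords k) → combine g h ≢ k
  combine≢ʳ {g} {h} h≢ eq =
    h≢ (trans (cong proj₂ (sym (coords-combine g h))) (cong (proj₂ ∘ coords) eq))

  -- Along an H-edge the G-coordinate is fixed, so w lies outside F₁ ⊠ F₂ only by lying
  -- outside F₂, and the fort property of F₂ applies in that H-fibre (symmetrically for G-edges).
  fort-□ : ∀ {F₁ F₂} → IsFort G F₁ → IsFort H F₂ → IsFort (G □ H) (F₁ ⊠ F₂)
  fort-□ {F₁} {F₂} fort₁ fort₂ {w} {v} w∉F (F₁v , F₂v) wv with □-adj⁻ wv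
  ... | inj₁ (g≡ , hh′) with F₁g ← subst F₁ (sym g≡) F₁v
                        with fort₂ (λ F₂h → w∉F (F₁g , F₂h)) F₂v hh′
  ...   | h′ , h′≢ , F₂h′ , hh″ =
    _ , combine≢ʳ h′≢ , ⊠-combine {F₁ = F₁} {F₂} F₁g F₂h′ , □-adjᴴ refl hh″
  fort-□ {F₁} {F₂} fort₁ fort₂ {w} {v} w∉F (F₁v , F₂v) wv
      | inj₂ (h≡ , gg′) with F₂h ← subst F₂ (sym h≡) F₂v
                        with fort₁ (λ F₁g → w∉F (F₁g , F₂h)) F₁v gg′
  ...   | g′ , g′≢ , F₁g′ , gg″ =
    _ , combine≢ˡ g′≢ , ⊠-combine {F₁ = F₁} {F₂} F₁g′ F₂h , □-adjᴳ refl gg″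

record TwoLeaves (G : Graph) (u : Fin (n G)) : Set where
  field
    leaf₁ leaf₂ : Fin (n G)
    leaf₁≢leaf₂ : leaf₁ ≢ leaf₂
    adj₁        : T (adj G u leaf₁)
    adj₂        : T (adj G u leaf₂)
    isLeaf₁     : T (isLeaf G leaf₁)
    isLeaf₂     : T (isLeaf G leaf₂)

  Leaves : Pred (Fin (n G)) 0ℓ
  Leaves v = v ≡ leaf₁ ⊎ v ≡ leaf₂

  Leaves? : Decidable Leaves
  Leaves? v = (v ≟ leaf₁) ⊎-dec (v ≟ leaf₂)

  Leaves⇒adjacent-leaf : ∀ {v} → Leaves v → T (adj G u v) × T (isLeaf G v)
  Leaves⇒adjacent-leaf (inj₁ refl) = adj₁ , isLeaf₁
  Leaves⇒adjacent-leaf (inj₂ refl) = adj₂ , isLeaf₂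

  other-leaf : ∀ {v} → Leaves v → ∃[ v′ ] v′ ≢ v × Leaves v′ × T (adj G u v′)
  other-leaf (inj₁ refl) = leaf₂ , leaf₁≢leaf₂ ∘ sym , inj₂ refl , adj₂
  other-leaf (inj₂ refl) = leaf₁ , leaf₁≢leaf₂ , inj₁ refl , adj₁

strongSupport⇒2≤leafNeighbours : ∀ k → T (not (k ≡ᵇ 0) ∧ not (k ≡ᵇ 1)) → 2 ≤ k
strongSupport⇒2≤leafNeighbours (suc (suc k)) _ = s≤s (s≤s z≤n)

strongSupport⇒TwoLeaves : ∀ G {u} → T (isStrongSupport G u) → TwoLeaves G u
strongSupport⇒TwoLeaves G {u} ss
  with a , b , a∈ , b∈ , a≢b ← 2≤∣p∣⇒∃x∈p∧y∈p∧x≢y _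
         (strongSupport⇒2≤leafNeighbours (leafNeighbours G u) ss)
  with adj₁ , isLeaf₁ ← Equivalence.to T-∧ (∈-tabulate⁻ a∈)
  with adj₂ , isLeaf₂ ← Equivalence.to T-∧ (∈-tabulate⁻ b∈)
  = record { leaf₁ = a ; leaf₂ = b ; leaf₁≢leaf₂ = a≢b
           ; adj₁ = adj₁ ; adj₂ = adj₂ ; isLeaf₁ = isLeaf₁ ; isLeaf₂ = isLeaf₂ }

module _ {G : Graph} (simple : IsSimple G) where
  open IsSimple simple

  adjacent⇒∈-N : ∀ {w ℓ} → T (adj G w ℓ) → w ∈ N G ℓ
  adjacent⇒∈-N {w} {ℓ} wℓ = ∈-tabulate⁺ (subst T (symmetric w ℓ) wℓ)

  leaf-neighbour-unique : ∀ {ℓ u v} → T (isLeaf G ℓ) → T (adj G u ℓ) → T (adj G v ℓ) → u ≡ v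
  leaf-neighbour-unique {ℓ} {u} {v} leaf uℓ vℓ with u ≟ v
  ... | yes u≡v = u≡v
  ... | no u≢v = ⊥-elim (1+n≰n (subst (2 ≤_) (≡ᵇ⇒≡ (degree G ℓ) 1 leaf)
                   (x∈p∧y∈p∧x≢y⇒2≤∣p∣ (adjacent⇒∈-N uℓ) (adjacent⇒∈-N vℓ) u≢v)))

  module _ {u} (leaves : TwoLeaves G u) where
    open TwoLeaves leaves

    -- Any neighbour of a leaf is u itself, which is adjacent to the other leaf as well.
    Leaves-fort : IsFort G Leaves
    Leaves-fort _ v∈ wv
      with uv , leaf ← Leaves⇒adjacent-leaf v∈
      with refl ← leaf-neighbour-unique leaf wv uv
      = other-leaf v∈

  Leaves-disjoint : ∀ {u u′} (s : TwoLeaves G u) (s′ : TwoLeaves G u′) {v} →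
                    TwoLeaves.Leaves s v → TwoLeaves.Leaves s′ v → u ≡ u′
  Leaves-disjoint s s′ v∈ v∈′
    with uv , leaf ← TwoLeaves.Leaves⇒adjacent-leaf s v∈
    with u′v , _ ← TwoLeaves.Leaves⇒adjacent-leaf s′ v∈′
    = leaf-neighbour-unique leaf uv u′v

strongSupport : ∀ G → Fin (vs G) → Fin (n G)
strongSupport G = enumerate (tabulate (isStrongSupport G))

leavesOf : ∀ G (i : Fin (vs G)) → TwoLeaves G (strongSupport G i)
leavesOf G i = strongSupport⇒TwoLeaves G (∈-tabulate⁻ {f = isStrongSupport G} (enumerate-∈ _ i))

module _ {G H : Graph} (simpleG : IsSimple G) (simpleH : IsSimple H) where

  block : Fin (vs G) → Fin (vs H) → Pred (Fin (n (G □ H))) 0ℓ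
  block i j = TwoLeaves.Leaves (leavesOf G i) ⊠ TwoLeaves.Leaves (leavesOf H j)

  block-fort : ∀ i j → IsFort (G □ H) (block i j)
  block-fort i j = fort-□ (Leaves-fort simpleG (leavesOf G i)) (Leaves-fort simpleH (leavesOf H j))

  block-nonempty : ∀ i j → ∃ (block i j)
  block-nonempty i j = _ , ⊠-combine {F₁ = TwoLeaves.Leaves (leavesOf G i)}
                                      {TwoLeaves.Leaves (leavesOf H j)} (inj₁ refl) (inj₁ refl)

  block-disjoint : ∀ {i j i′ j′ k} → block i j k → block i′ j′ k → (i , j) ≡ (i′ , j′)
  block-disjoint (g∈ , h∈) (g∈′ , h∈′) = cong₂ _,_
    (enumerate-injective _ (Leaves-disjoint simpleG (leavesOf G _) (leavesOf G _) g∈ g∈′))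
    (enumerate-injective _ (Leaves-disjoint simpleH (leavesOf H _) (leavesOf H _) h∈ h∈′))

  module _ {S : Subset (n (G □ H))} (zf : IsZeroForcingSet (G □ H) S) where

    S-meets-block : ∀ i j → ∃[ k ] k ∈ S × block i j k
    S-meets-block i j = zeroForcingSet-meets-fort
      (⊠-dec (TwoLeaves.Leaves? (leavesOf G i)) (TwoLeaves.Leaves? (leavesOf H j)))
      (block-fort i j) zf (block-nonempty i j)

    witness : Fin (vs G) → Fin (vs H) → Fin (n (G □ H))
    witness i j = proj₁ (S-meets-block i j)

    witness-∈S : ∀ i j → witness i j ∈ S
    witness-∈S i j = proj₁ (proj₂ (S-meets-block i j))

    witness-∈block : ∀ i j → block i j (witness i j)
    witness-∈block i j = proj₂ (proj₂ (S-meets-block i j))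

    S-rank : Fin (vs G) × Fin (vs H) → Fin ∣ S ∣
    S-rank (i , j) = rank S (witness-∈S i j)

    S-rank-injective : Injective _≡_ _≡_ S-rank
    S-rank-injective {i , j} {i′ , j′} eq = block-disjoint (witness-∈block i j)
      (subst (block i′ j′) (sym (rank-injective S (witness-∈S i j) (witness-∈S i′ j′) eq))
             (witness-∈block i′ j′))

corollary3p6 : (G H : Graph) → IsSimple G → IsSimple H → Connected G → Connected H
    → (S : Subset (n (G □ H))) → IsZeroForcingSet (G □ H) S
    → vs G * vs H ≤ ∣ S ∣
corollary3p6 G H simpleG simpleH _ _ S zf =
  injective⇒≤ {f = S-rank simpleG simpleH zf ∘ remQuot (vs H)}
    (remQuot-injective (vs H) ∘ S-rank-injective simpleG simpleH zf)
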